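{- Let $m\in[n]$, $U\subseteq\binom{[n]}{m}$, and $l_0\in[n]$ with $m^2\ll n$ and $m^2<l_0$. For positive integers $i$ let $U_i=Ext(U,il_0)$ (so $U_1=Ext(U,l_0)$). Fix a positive integer $i$ with $(i+1)l_0\le n$ and any $b\in\binom{[n]}{il_0}\setminus U_i$. Then the family $\{s\in\binom{[n]\setminus b}{l_0}: s\cup b\in U_{i+1}\}$ has sparsity at most $\kappa(U_1)$ in the space $[n]\setminus b$, i.e. its cardinality is at least $\binom{n-il_0}{l_0}e^{ -\kappa(U_1)}$.
   Context: $[n]=\{1,\dots,n\}$, $\binom{X}{m}$ is the family of $m$-subsets of $X$; $n\to\infty$ with all quantities functions of $n$, and $f\ll g$ means $f/g\to0$. $Ext(U,l)=\{t\in\binom{[n]}{l}:\exists s\in U,\ s\subseteq t\}$. For nonempty $W\subseteq\binom{[n]}{l}$, $\kappa(W)=\ln\binom{n}{l}-\ln|W|$; for a family $W\subseteq\binom{Y}{l}$ in a subspace $Y\subseteq[n]$, its sparsity in the space $Y$ is $\ln\binom{|Y|}{l}-\ln|W|$. -}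

module Defs where

open import Data.Nat using (ℕ; zero; suc; _≟_)
open import Data.Bool using (true; false)
open import Data.Vec using ([]; _∷_)
open import Data.List using (List; [_]; map; _++_; filter; length)
open import Data.List.Relation.Unary.Any using (Any; any?)
open import Data.Product using (_×_)
open import Relation.Nullary using (Dec)
open import Relation.Nullary.Decidable using (_×-dec_)
open import Data.Fin.Subset using (Subset; _⊆_; ∣_∣; _∪_; ∁)
open import Data.Fin.Subset.Properties using (_⊆?_)
open import Relation.Binary.PropositionalEquality using (_≡_)

allSubsets : (n : ℕ) → List (Subset n)
allSubsets zero = [ [] ]
allSubsets (suc n) = map (true ∷_) (allSubsets n) ++ map (false ∷_) (allSubsets n)

-- Ext(U,l) as a membership predicate: t is an l-subset containing some s ∈ U.
-- A family U ⊆ binom([n],m) is represented by a list of its members.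
InExt : {n : ℕ} → List (Subset n) → ℕ → Subset n → Set
InExt U l t = (∣ t ∣ ≡ l) × Any (_⊆ t) U

inExt? : {n : ℕ} (U : List (Subset n)) (l : ℕ) (t : Subset n) → Dec (InExt U l t)
inExt? U l t = (∣ t ∣ ≟ l) ×-dec any? (_⊆? t) U

extCard : {n : ℕ} → List (Subset n) → ℕ → ℕ
extCard {n} U l = length (filter (inExt? U l) (allSubsets n))

InLink : {n : ℕ} → List (Subset n) → ℕ → ℕ → Subset n → Subset n → Set
InLink U l0 l' b s = (∣ s ∣ ≡ l0) × (s ⊆ ∁ b) × InExt U l' (s ∪ b)

inLink? : {n : ℕ} (U : List (Subset n)) (l0 l' : ℕ) (b s : Subset n) → Dec (InLink U l0 l' b s)
inLink? U l0 l' b s = (∣ s ∣ ≟ l0) ×-dec ((s ⊆? ∁ b) ×-dec inExt? U l' (s ∪ b))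

linkCard : {n : ℕ} → List (Subset n) → ℕ → ℕ → Subset n → ℕ
linkCard {n} U l0 l' b = length (filter (inLink? U l0 l' b) (allSubsets n))

-- Lemma 3.3: links of an up-closed family are at least as dense as the family.
--
-- Let f be an up-closed family of subsets of [n], let b ⊆ [n] with F = n - |b|
-- free elements, and let the link of f at b be the family of sets s in the
-- complement of b with s ∪ b ∈ f.  Then for every level l
--     C(F,l) · |f_l|  ≤  |link_l| · C(n,l).
-- Proof.  (1) Every l-set t ∈ f splits as t ∖ b (a member of the link, as f is
-- up-closed) plus l - j points of b, so |f_l| ≤ Σ_j C(|b|, l-j) |link_j|.
-- (2) The link is up-closed on its F-element ground set, so by the local LYM
-- inequality its densities |link_j| / C(F,j) are non-decreasing in j; thus
-- |link_j| C(F,l) ≤ |link_l| C(F,j) for j ≤ l.  (3) Vandermonde's identity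
-- Σ_j C(|b|, l-j) C(F,j) = C(n,l) finishes the estimate.
module Submission where

open import Data.Bool using (Bool; true; false; _∧_; T; if_then_else_)
open import Data.Bool.Properties using (∧-zeroʳ)
open import Data.Nat
open import Data.Nat.Properties
open import Data.Nat.Combinatorics using (_C_; nCk+nC[k+1]≡[n+1]C[k+1]; nC1≡n; k>n⇒nCk≡0)
open import Data.Nat.Tactic.RingSolver using (solve-∀)
open import Algebra.Properties.CommutativeSemigroup *-commutativeSemigroup using (x∙yz≈xz∙y; xy∙z≈xz∙y)
open import Data.Product using (∃; _×_; _,_)
open import Data.Unit using (⊤; tt)
open import Data.Empty using (⊥-elim)
open import Data.Vec using ([]; _∷_)
open import Data.List using (List; map; _++_; filter; length)
open import Data.List.Properties using (length-++; filter-++)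
open import Data.List.Relation.Unary.All using (All)
open import Data.List.Relation.Unary.Any using (any?)
import Data.List.Relation.Unary.Any as Any
open import Data.Fin.Subset using (Subset; _⊆_; ∣_∣; _∪_; ∁)
open import Data.Fin.Subset.Properties using (_⊆?_; out⊆; in⊆in; ⊆-refl; ⊆-trans; ∣p∣≤n; ∣∁p∣≡n∸∣p∣)
open import Relation.Nullary using (Dec; does; yes; no; ¬_)
open import Relation.Unary using (Decidable)
open import Relation.Binary.PropositionalEquality
open import Defs

Family : ℕ → Set
Family n = Subset n → Bool

avoid contain : ∀ {n} → Family (suc n) → Family n
avoid f t = f (false ∷ t)
contain f t = f (true ∷ t)

_⊑_ : ∀ {n} → Family n → Family n → Set
f ⊑ g = ∀ t → T (f t) → T (g t)

UpClosed : ∀ {n} → Family n → Set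
UpClosed {zero} f = ⊤
UpClosed {suc n} f = UpClosed (avoid f) × UpClosed (contain f) × avoid f ⊑ contain f

⊆-closed⇒UpClosed : ∀ {n} (f : Family n) → (∀ {t t'} → t ⊆ t' → T (f t) → T (f t')) → UpClosed f
⊆-closed⇒UpClosed {zero} f closed = tt
⊆-closed⇒UpClosed {suc n} f closed =
  ⊆-closed⇒UpClosed (avoid f) (λ t⊆t' → closed (out⊆ t⊆t')) ,
  ⊆-closed⇒UpClosed (contain f) (λ t⊆t' → closed (in⊆in t⊆t')) ,
  (λ t → closed (out⊆ ⊆-refl))

level : ∀ n → Family n → ℕ → ℕ
level zero f zero = if f [] then 1 else 0
level zero f (suc l) = 0
level (suc n) f zero = level n (avoid f) zero
level (suc n) f (suc l) = level n (avoid f) (suc l) + level n (contain f) l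

level-mono : ∀ n {f g : Family n} → f ⊑ g → ∀ l → level n f l ≤ level n g l
level-mono zero {f} {g} f⊑g zero with f [] | g [] | f⊑g []
... | false | _ | _ = z≤n
... | true | true | _ = ≤-refl
... | true | false | absurd = ⊥-elim (absurd tt)
level-mono zero f⊑g (suc l) = z≤n
level-mono (suc n) f⊑g zero = level-mono n (λ t → f⊑g (false ∷ t)) zero
level-mono (suc n) f⊑g (suc l) =
  +-mono-≤ (level-mono n (λ t → f⊑g (false ∷ t)) (suc l)) (level-mono n (λ t → f⊑g (true ∷ t)) l)

-- embed b s places s ⊆ [|∁ b|] on the positions outside b.
embed : ∀ {n} (b : Subset n) → Subset ∣ ∁ b ∣ → Subset n
embed [] [] = []
embed (true ∷ b) s = false ∷ embed b s
embed (false ∷ b) (x ∷ s) = x ∷ embed b s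

link : ∀ {n} → Family n → (b : Subset n) → Family ∣ ∁ b ∣
link f b s = f (embed b s ∪ b)

link-upClosed : ∀ {n} (f : Family n) → UpClosed f → (b : Subset n) → UpClosed (link f b)
link-upClosed f _ [] = tt
link-upClosed f (_ , up₁ , _) (true ∷ b) = link-upClosed (contain f) up₁ b
link-upClosed f (up₀ , up₁ , avoid⊑contain) (false ∷ b) =
  link-upClosed (avoid f) up₀ b , link-upClosed (contain f) up₁ b ,
  (λ s → avoid⊑contain (embed b s ∪ b))

embed-size : ∀ {n} (b : Subset n) (s : Subset ∣ ∁ b ∣) → ∣ embed b s ∣ ≡ ∣ s ∣
embed-size [] [] = refl
embed-size (true ∷ b) s = embed-size b s
embed-size (false ∷ b) (true ∷ s) = cong suc (embed-size b s)
embed-size (false ∷ b) (false ∷ s) = embed-size b s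

embed-∪-size : ∀ {n} (b : Subset n) (s : Subset ∣ ∁ b ∣) → ∣ embed b s ∪ b ∣ ≡ ∣ s ∣ + ∣ b ∣
embed-∪-size [] [] = refl
embed-∪-size (true ∷ b) s = trans (cong suc (embed-∪-size b s)) (sym (+-suc ∣ s ∣ ∣ b ∣))
embed-∪-size (false ∷ b) (true ∷ s) = cong suc (embed-∪-size b s)
embed-∪-size (false ∷ b) (false ∷ s) = embed-∪-size b s

∣b∣+∣∁b∣≡n : ∀ {n} (b : Subset n) → ∣ b ∣ + ∣ ∁ b ∣ ≡ n
∣b∣+∣∁b∣≡n b = trans (cong (∣ b ∣ +_) (∣∁p∣≡n∸∣p∣ b)) (m+[n∸m]≡n (∣p∣≤n b))

LocalLYM : ℕ → (ℕ → ℕ) → Set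
LocalLYM N g = ∀ j → g j * (N ∸ j) ≤ g (suc j) * suc j

-- Arithmetic for the inductive step of the LYM inequality: with a the level
-- counts of the avoiding half and c those of the containing half, the
-- inequalities for both halves and a ≤ c combine to the inequality for the
-- whole family (at level 0, resp. at a level j+1 with N - j = d + 1).
private
  lym-base : ∀ {a₀ a₁ c₀} N → a₀ * N ≤ a₁ * 1 → a₀ ≤ c₀ → a₀ * suc N ≤ (a₁ + c₀) * 1
  lym-base {a₀} {a₁} {c₀} N avoid-step a₀≤c₀ = begin
    a₀ * suc N          ≡⟨ expandˡ a₀ N ⟩
    a₀ * N + a₀         ≤⟨ +-mono-≤ avoid-step a₀≤c₀ ⟩
    a₁ * 1 + c₀         ≡⟨ expandʳ a₁ c₀ ⟩
    (a₁ + c₀) * 1       ∎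
    where
      open ≤-Reasoning
      expandˡ : ∀ a N → a * suc N ≡ a * N + a
      expandˡ = solve-∀
      expandʳ : ∀ a c → a * 1 + c ≡ (a + c) * 1
      expandʳ = solve-∀

  lym-step : ∀ {a₁ a₂ c₀ c₁} d j → a₁ * d ≤ a₂ * suc (suc j) → c₀ * suc d ≤ c₁ * suc j → a₁ ≤ c₁
           → (a₁ + c₀) * suc d ≤ (a₂ + c₁) * suc (suc j)
  lym-step {a₁} {a₂} {c₀} {c₁} d j avoid-step contain-step a₁≤c₁ = begin
    (a₁ + c₀) * suc d                     ≡⟨ expandˡ a₁ c₀ d ⟩
    a₁ * d + (a₁ + c₀ * suc d)            ≤⟨ +-mono-≤ avoid-step (+-mono-≤ a₁≤c₁ contain-step) ⟩
    a₂ * suc (suc j) + (c₁ + c₁ * suc j)  ≡⟨ expandʳ a₂ c₁ j ⟩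
    (a₂ + c₁) * suc (suc j)               ∎
    where
      open ≤-Reasoning
      expandˡ : ∀ a c d → (a + c) * suc d ≡ a * d + (a + c * suc d)
      expandˡ = solve-∀
      expandʳ : ∀ a c j → a * suc (suc j) + (c + c * suc j) ≡ (a + c) * suc (suc j)
      expandʳ = solve-∀

-- Splitting by the
-- first element, it follows from the inequality for both halves together with
-- the inclusion of the avoiding half in the containing half.
upClosed-LYM : ∀ N (g : Family N) → UpClosed g → LocalLYM N (level N g)
upClosed-LYM zero g _ j rewrite 0∸n≡0 j | *-zeroʳ (level zero g j) = z≤n
upClosed-LYM (suc N) g (up₀ , up₁ , avoid⊑contain) zero =
  lym-base {a₁ = level N (avoid g) 1} N (upClosed-LYM N (avoid g) up₀ 0) (level-mono N avoid⊑contain 0)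
upClosed-LYM (suc N) g (up₀ , up₁ , avoid⊑contain) (suc j) with N ∸ j in N∸j≡
... | zero rewrite *-zeroʳ (level (suc N) g (suc j)) = z≤n
... | suc d = lym-step {a₂ = level N (avoid g) (suc (suc j))} d j
                       avoid-step contain-step (level-mono N avoid⊑contain (suc j))
  where
    avoid-step : level N (avoid g) (suc j) * d ≤ level N (avoid g) (suc (suc j)) * suc (suc j)
    avoid-step = subst (λ e → level N (avoid g) (suc j) * e ≤ level N (avoid g) (suc (suc j)) * suc (suc j))
                       (trans (sym (pred[m∸n]≡m∸[1+n] N j)) (cong pred N∸j≡))
                       (upClosed-LYM N (avoid g) up₀ (suc j))
    contain-step : level N (contain g) j * suc d ≤ level N (contain g) (suc j) * suc j
    contain-step = subst (λ e → level N (contain g) j * e ≤ level N (contain g) (suc j) * suc j)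
                         N∸j≡ (upClosed-LYM N (contain g) up₁ j)

pascal : ∀ N j → N C suc j + N C j ≡ suc N C suc j
pascal N j = trans (+-comm (N C suc j) (N C j)) (nCk+nC[k+1]≡[n+1]C[k+1] N j)

absorption-sum : ∀ N j → (N C suc j) * suc j + (N C j) * j ≡ (N C j) * N
absorption-sum zero zero = refl
absorption-sum zero (suc j) = refl
absorption-sum (suc N) zero rewrite nC1≡n (suc N) = unit (suc N)
  where
    unit : ∀ M → M * 1 + 1 * 0 ≡ 1 * M
    unit = solve-∀
absorption-sum (suc N) (suc j) = begin
    (suc N C suc (suc j)) * suc (suc j) + (suc N C suc j) * suc j
      ≡⟨ cong₂ (λ x y → x * suc (suc j) + y * suc j) (sym (pascal N (suc j))) (sym (pascal N j)) ⟩
    (c + b) * suc (suc j) + (b + a) * suc j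
      ≡⟨ regroup a b c j ⟩
    (c * suc (suc j) + b * suc j) + (b * suc j + a * j) + (b + a)
      ≡⟨ cong₂ (λ x y → x + y + (b + a)) (absorption-sum N (suc j)) (absorption-sum N j) ⟩
    b * N + a * N + (b + a)
      ≡⟨ collect a b N ⟩
    (b + a) * suc N
      ≡⟨ cong (_* suc N) (pascal N j) ⟩
    (suc N C suc j) * suc N ∎
  where
    open ≡-Reasoning
    a = N C j
    b = N C suc j
    c = N C suc (suc j)
    regroup : ∀ a b c j → (c + b) * suc (suc j) + (b + a) * suc j
                        ≡ (c * suc (suc j) + b * suc j) + (b * suc j + a * j) + (b + a)
    regroup = solve-∀
    collect : ∀ a b N → b * N + a * N + (b + a) ≡ (b + a) * suc N
    collect = solve-∀

absorption : ∀ N j → (N C suc j) * suc j ≡ (N C j) * (N ∸ j)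
absorption N j with j ≤? N
... | yes j≤N = +-cancelʳ-≡ ((N C j) * j) _ _ (begin
    (N C suc j) * suc j + (N C j) * j   ≡⟨ absorption-sum N j ⟩
    (N C j) * N                         ≡⟨ cong ((N C j) *_) (m+[n∸m]≡n j≤N) ⟨
    (N C j) * (j + (N ∸ j))             ≡⟨ *-distribˡ-+ (N C j) j (N ∸ j) ⟩
    (N C j) * j + (N C j) * (N ∸ j)     ≡⟨ +-comm ((N C j) * j) _ ⟩
    (N C j) * (N ∸ j) + (N C j) * j     ∎)
  where open ≡-Reasoning
... | no j≰N rewrite k>n⇒nCk≡0 (≰⇒> j≰N) | k>n⇒nCk≡0 (m<n⇒m<1+n (≰⇒> j≰N)) = refl

C-pos : ∀ {N k} → k ≤ N → 0 < N C k
C-pos {N} {zero} _ = s≤s z≤n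
C-pos {suc N} {suc k} (s≤s k≤N) = <-≤-trans (C-pos k≤N) (subst ((N C k) ≤_) (pascal N k) (m≤n+m (N C k) _))

-- One step: g j C(N,j+1) ≤ g (j+1) C(N,j), i.e. the density g j / C(N,j)
-- does not decrease from j to j+1 (multiply the LYM inequality by C(N,j)
-- and use the absorption identity).
density-step : ∀ {N g} → LocalLYM N g → ∀ j → g j * (N C suc j) ≤ g (suc j) * (N C j)
density-step {N} {g} lym j = *-cancelʳ-≤ _ _ (suc j) (begin
    g j * (N C suc j) * suc j        ≡⟨ *-assoc (g j) (N C suc j) (suc j) ⟩
    g j * ((N C suc j) * suc j)      ≡⟨ cong (g j *_) (absorption N j) ⟩
    g j * ((N C j) * (N ∸ j))        ≡⟨ x∙yz≈xz∙y (g j) (N C j) (N ∸ j) ⟩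
    g j * (N ∸ j) * (N C j)          ≤⟨ *-monoˡ-≤ (N C j) (lym j) ⟩
    g (suc j) * suc j * (N C j)      ≡⟨ xy∙z≈xz∙y (g (suc j)) (suc j) (N C j) ⟩
    g (suc j) * (N C j) * suc j      ∎)
  where open ≤-Reasoning

-- Density monotonicity: g j C(N,l) ≤ g l C(N,j) whenever j ≤ l.  Steps are
-- chained by cancelling the positive factor C(N,m) at the intermediate level m.
density-mono : ∀ {N g} → LocalLYM N g → ∀ {j l} → j ≤ l → g j * (N C l) ≤ g l * (N C j)
density-mono {N} {g} lym {j} {l} j≤l =
  subst (λ l → g j * (N C l) ≤ g l * (N C j)) (m+[n∸m]≡n j≤l) (chain (l ∸ j))
  where
    open ≤-Reasoning
    chain : ∀ d → g j * (N C (j + d)) ≤ g (j + d) * (N C j)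
    chain zero rewrite +-identityʳ j = ≤-refl
    chain (suc d) rewrite +-suc j d with suc (j + d) ≤? N
    ... | no m≰N rewrite k>n⇒nCk≡0 (≰⇒> m≰N) | *-zeroʳ (g j) = z≤n
    ... | yes m<N = *-cancelʳ-≤ _ _ (N C m) {{>-nonZero (C-pos (<⇒≤ m<N))}} (begin
        g j * (N C suc m) * (N C m)      ≡⟨ xy∙z≈xz∙y (g j) (N C suc m) (N C m) ⟩
        g j * (N C m) * (N C suc m)      ≤⟨ *-monoˡ-≤ (N C suc m) (chain d) ⟩
        g m * (N C j) * (N C suc m)      ≡⟨ xy∙z≈xz∙y (g m) (N C j) (N C suc m) ⟩
        g m * (N C suc m) * (N C j)      ≤⟨ *-monoˡ-≤ (N C j) (density-step {N} {g} lym m) ⟩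
        g (suc m) * (N C m) * (N C j)    ≡⟨ xy∙z≈xz∙y (g (suc m)) (N C m) (N C j) ⟩
        g (suc m) * (N C j) * (N C m)    ∎)
      where m = j + d

-- spread k h l = Σ_j C(k, l-j) h j: the number of l-sets on a ground set
-- enlarged by k new points whose trace on the old points is counted by h.
-- It is defined by adding the new points one at a time (Pascal's rule).
spread : ℕ → (ℕ → ℕ) → ℕ → ℕ
spread zero h l = h l
spread (suc k) h zero = spread k h zero
spread (suc k) h (suc l) = spread k h (suc l) + spread k h l

-- shift h counts the sets of h enlarged by one fixed new point.
shift : (ℕ → ℕ) → ℕ → ℕ
shift h zero = 0
shift h (suc j) = h j

spread-mono : ∀ k {h h'} l → (∀ j → j ≤ l → h j ≤ h' j) → spread k h l ≤ spread k h' l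
spread-mono zero l h≤h' = h≤h' l ≤-refl
spread-mono (suc k) zero h≤h' = spread-mono k zero h≤h'
spread-mono (suc k) (suc l) h≤h' =
  +-mono-≤ (spread-mono k (suc l) h≤h') (spread-mono k l (λ j j≤l → h≤h' j (m≤n⇒m≤1+n j≤l)))

-- spread k is linear and commutes with shift (it acts on new points only).
spread-+ : ∀ k h h' l → spread k (λ j → h j + h' j) l ≡ spread k h l + spread k h' l
spread-+ zero h h' l = refl
spread-+ (suc k) h h' zero = spread-+ k h h' zero
spread-+ (suc k) h h' (suc l) rewrite spread-+ k h h' (suc l) | spread-+ k h h' l =
  +-+-interchange (spread k h (suc l)) (spread k h' (suc l)) (spread k h l) (spread k h' l)
  where
    +-+-interchange : ∀ a b c d → (a + b) + (c + d) ≡ (a + c) + (b + d)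
    +-+-interchange = solve-∀

spread-*ˡ : ∀ k c h l → spread k (λ j → c * h j) l ≡ c * spread k h l
spread-*ˡ zero c h l = refl
spread-*ˡ (suc k) c h zero = spread-*ˡ k c h zero
spread-*ˡ (suc k) c h (suc l) rewrite spread-*ˡ k c h (suc l) | spread-*ˡ k c h l =
  sym (*-distribˡ-+ c (spread k h (suc l)) (spread k h l))

spread-shift : ∀ k h l → spread k (shift h) l ≡ shift (spread k h) l
spread-shift zero h l = refl
spread-shift (suc k) h zero = spread-shift k h zero
spread-shift (suc k) h (suc zero) rewrite spread-shift k h 1 | spread-shift k h 0 = +-identityʳ (spread k h 0)
spread-shift (suc k) h (suc (suc l)) rewrite spread-shift k h (suc l) | spread-shift k h (suc (suc l)) = refl

spread-binomial : ∀ k N l → spread k (N C_) l ≡ (k + N) C l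
spread-binomial zero N l = refl
spread-binomial (suc k) N zero = spread-binomial k N zero
spread-binomial (suc k) N (suc l) rewrite spread-binomial k N (suc l) | spread-binomial k N l = pascal (k + N) l

-- A set on [1+n] either avoids the first element or consists of it together
-- with a set one level lower.
level-split : ∀ n (f : Family (suc n)) j → level (suc n) f j ≡ level n (avoid f) j + shift (level n (contain f)) j
level-split n f zero = sym (+-identityʳ (level n (avoid f) zero))
level-split n f (suc j) = refl

shift-mono : ∀ {h h'} → (∀ j → h j ≤ h' j) → ∀ j → shift h j ≤ shift h' j
shift-mono h≤h' zero = z≤n
shift-mono h≤h' (suc j) = h≤h' j

-- Step (1): an l-set t ∈ f is the union of t ∖ b, which lies in the link since
-- f is up-closed, and l - j points of b.  Hence |f_l| ≤ Σ_j C(|b|, l-j) |link_j|.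
level≤spread-link : ∀ {n} (f : Family n) → UpClosed f → (b : Subset n) (l : ℕ)
                  → level n f l ≤ spread ∣ b ∣ (level ∣ ∁ b ∣ (link f b)) l
level≤spread-link f _ [] zero = ≤-refl
level≤spread-link f _ [] (suc l) = z≤n
level≤spread-link {suc n} f (_ , up₁ , avoid⊑contain) (true ∷ b) zero =
  ≤-trans (level-mono n avoid⊑contain zero) (level≤spread-link (contain f) up₁ b zero)
level≤spread-link {suc n} f (_ , up₁ , avoid⊑contain) (true ∷ b) (suc l) =
  +-mono-≤ (≤-trans (level-mono n avoid⊑contain (suc l)) (level≤spread-link (contain f) up₁ b (suc l)))
           (level≤spread-link (contain f) up₁ b l)
level≤spread-link {suc n} f (up₀ , up₁ , _) (false ∷ b) l = begin
    level (suc n) f l                               ≡⟨ level-split n f l ⟩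
    level n (avoid f) l + shift (level n (contain f)) l
      ≤⟨ +-mono-≤ (level≤spread-link (avoid f) up₀ b l)
                  (shift-mono (level≤spread-link (contain f) up₁ b) l) ⟩
    spread k g₀ l + shift (spread k g₁) l           ≡⟨ cong (spread k g₀ l +_) (spread-shift k g₁ l) ⟨
    spread k g₀ l + spread k (shift g₁) l           ≡⟨ spread-+ k g₀ (shift g₁) l ⟨
    spread k (λ j → g₀ j + shift g₁ j) l
      ≤⟨ spread-mono k l (λ j _ → ≤-reflexive (sym (level-split ∣ ∁ b ∣ (link f (false ∷ b)) j))) ⟩
    spread k (level (suc ∣ ∁ b ∣) (link f (false ∷ b))) l ∎
  where
    open ≤-Reasoning
    k = ∣ b ∣
    g₀ = level ∣ ∁ b ∣ (link (avoid f) b)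
    g₁ = level ∣ ∁ b ∣ (link (contain f) b)

link-density : ∀ {n} (f : Family n) → UpClosed f → (b : Subset n) (l : ℕ)
             → (∣ ∁ b ∣ C l) * level n f l ≤ level ∣ ∁ b ∣ (link f b) l * (n C l)
link-density {n} f up b l = begin
    (F C l) * level n f l                    ≤⟨ *-monoʳ-≤ (F C l) (level≤spread-link f up b l) ⟩
    (F C l) * spread k g l                   ≡⟨ spread-*ˡ k (F C l) g l ⟨
    spread k (λ j → (F C l) * g j) l
      ≤⟨ spread-mono k l (λ j j≤l → ≤-trans (≤-reflexive (*-comm (F C l) (g j)))
                                            (density-mono {F} {g} lym j≤l)) ⟩
    spread k (λ j → g l * (F C j)) l          ≡⟨ spread-*ˡ k (g l) (F C_) l ⟩
    g l * spread k (F C_) l                   ≡⟨ cong (g l *_) (spread-binomial k F l) ⟩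
    g l * ((k + F) C l)                       ≡⟨ cong (λ m → g l * (m C l)) (∣b∣+∣∁b∣≡n b) ⟩
    g l * (n C l)                             ∎
  where
    open ≤-Reasoning
    k = ∣ b ∣
    F = ∣ ∁ b ∣
    g = level F (link f b)
    lym : LocalLYM F g
    lym = upClosed-LYM F (link f b) (link-upClosed f up b)

-- Number of members of a family, following the order of allSubsets.
count : ∀ n → Family n → ℕ
count zero f = if f [] then 1 else 0
count (suc n) f = count n (contain f) + count n (avoid f)

count-cong : ∀ n {f g : Family n} → (∀ t → f t ≡ g t) → count n f ≡ count n g
count-cong zero f≡g rewrite f≡g [] = refl
count-cong (suc n) f≡g = cong₂ _+_ (count-cong n (λ t → f≡g (true ∷ t))) (count-cong n (λ t → f≡g (false ∷ t)))

count-empty : ∀ n → count n (λ _ → false) ≡ 0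
count-empty zero = refl
count-empty (suc n) = cong₂ _+_ (count-empty n) (count-empty n)

count-level : ∀ n (f : Family n) l → count n (λ t → (∣ t ∣ ≡ᵇ l) ∧ f t) ≡ level n f l
count-level zero f zero = refl
count-level zero f (suc l) = refl
count-level (suc n) f zero = cong₂ _+_ (count-empty n) (count-level n (avoid f) zero)
count-level (suc n) f (suc l) =
  trans (cong₂ _+_ (count-level n (contain f) l) (count-level n (avoid f) (suc l)))
        (+-comm (level n (contain f) l) (level n (avoid f) (suc l)))

count-disjoint : ∀ {n} (b : Subset n) (φ : Family n)
               → count n (λ s → does (s ⊆? ∁ b) ∧ φ s) ≡ count ∣ ∁ b ∣ (λ s → φ (embed b s))
count-disjoint [] φ = refl
count-disjoint {suc n} (true ∷ b) φ = cong₂ _+_ (count-empty n) (count-disjoint b (λ s → φ (false ∷ s)))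
count-disjoint (false ∷ b) φ =
  cong₂ _+_ (count-disjoint b (λ s → φ (true ∷ s))) (count-disjoint b (λ s → φ (false ∷ s)))

length-filter-map : ∀ {A B : Set} {P : B → Set} (P? : Decidable P) (g : A → B) (xs : List A)
                  → length (filter P? (map g xs)) ≡ length (filter (λ x → P? (g x)) xs)
length-filter-map P? g List.[] = refl
length-filter-map P? g (x List.∷ xs) with does (P? (g x))
... | true = cong suc (length-filter-map P? g xs)
... | false = length-filter-map P? g xs

length-filter-allSubsets : ∀ n {P : Subset n → Set} (P? : Decidable P)
                         → length (filter P? (allSubsets n)) ≡ count n (λ t → does (P? t))
length-filter-allSubsets zero P? with does (P? [])
... | true = refl
... | false = refl
length-filter-allSubsets (suc n) P? = begin
    length (filter P? (map (true ∷_) all ++ map (false ∷_) all))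
      ≡⟨ cong length (filter-++ P? (map (true ∷_) all) (map (false ∷_) all)) ⟩
    length (filter P? (map (true ∷_) all) ++ filter P? (map (false ∷_) all))
      ≡⟨ length-++ (filter P? (map (true ∷_) all)) ⟩
    length (filter P? (map (true ∷_) all)) + length (filter P? (map (false ∷_) all))
      ≡⟨ cong₂ _+_ (trans (length-filter-map P? (true ∷_) all) (length-filter-allSubsets n (λ t → P? (true ∷ t))))
                   (trans (length-filter-map P? (false ∷_) all) (length-filter-allSubsets n (λ t → P? (false ∷ t)))) ⟩
    count (suc n) (λ t → does (P? t)) ∎
  where
    open ≡-Reasoning
    all = allSubsets n

above : ∀ {n} → List (Subset n) → Family n
above U t = does (any? (_⊆? t) U)

does-sound : ∀ {A : Set} (d : Dec A) → T (does d) → A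
does-sound (yes a) _ = a

does-complete : ∀ {A : Set} (d : Dec A) → A → T (does d)
does-complete (yes _) _ = tt
does-complete (no ¬a) a = ¬a a

above-upClosed : ∀ {n} (U : List (Subset n)) → UpClosed (above U)
above-upClosed U = ⊆-closed⇒UpClosed (above U) λ {t} {t'} t⊆t' t∈above →
  does-complete (any? (_⊆? t') U)
    (Any.map {P = _⊆ t} {Q = _⊆ t'} (λ u⊆t → ⊆-trans u⊆t t⊆t') (does-sound (any? (_⊆? t) U) t∈above))

extCard≡level : ∀ {n} (U : List (Subset n)) l → extCard U l ≡ level n (above U) l
extCard≡level {n} U l = trans (length-filter-allSubsets n (inExt? U l)) (count-level n (above U) l)

private
  ≡ᵇ-refl : ∀ k → (k ≡ᵇ k) ≡ true
  ≡ᵇ-refl zero = refl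
  ≡ᵇ-refl (suc k) = ≡ᵇ-refl k

  ≡ᵇ-redundant : ∀ x l k p → (x ≡ᵇ l) ∧ ((x + k ≡ᵇ l + k) ∧ p) ≡ (x ≡ᵇ l) ∧ p
  ≡ᵇ-redundant zero zero k p rewrite ≡ᵇ-refl k = refl
  ≡ᵇ-redundant zero (suc l) k p = refl
  ≡ᵇ-redundant (suc x) zero k p = refl
  ≡ᵇ-redundant (suc x) (suc l) k p = ≡ᵇ-redundant x l k p

  ∧-swap : ∀ x y z → x ∧ (y ∧ z) ≡ y ∧ (x ∧ z)
  ∧-swap true y z = refl
  ∧-swap false y z = sym (∧-zeroʳ y)

linkCard≡level : ∀ {n} (U : List (Subset n)) l b
               → linkCard U l (l + ∣ b ∣) b ≡ level ∣ ∁ b ∣ (link (above U) b) l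
linkCard≡level {n} U l b = begin
    linkCard U l (l + ∣ b ∣) b
      ≡⟨ length-filter-allSubsets n (inLink? U l (l + ∣ b ∣) b) ⟩
    count n (λ s → (∣ s ∣ ≡ᵇ l) ∧ (does (s ⊆? ∁ b) ∧ φ′ s))
      ≡⟨ count-cong n (λ s → ∧-swap (∣ s ∣ ≡ᵇ l) (does (s ⊆? ∁ b)) (φ′ s)) ⟩
    count n (λ s → does (s ⊆? ∁ b) ∧ φ s)
      ≡⟨ count-disjoint b φ ⟩
    count F (λ s → φ (embed b s))
      ≡⟨ count-cong F in-link ⟩
    count F (λ s → (∣ s ∣ ≡ᵇ l) ∧ link (above U) b s)
      ≡⟨ count-level F (link (above U) b) l ⟩
    level F (link (above U) b) l ∎
  where
    open ≡-Reasoning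
    F = ∣ ∁ b ∣
    φ′ φ : Family n
    φ′ s = (∣ s ∪ b ∣ ≡ᵇ l + ∣ b ∣) ∧ above U (s ∪ b)
    φ s = (∣ s ∣ ≡ᵇ l) ∧ φ′ s
    in-link : ∀ s → φ (embed b s) ≡ (∣ s ∣ ≡ᵇ l) ∧ link (above U) b s
    in-link s rewrite embed-size b s | embed-∪-size b s = ≡ᵇ-redundant (∣ s ∣) l (∣ b ∣) (link (above U) b s)

ext-link-density : ∀ {n} (U : List (Subset n)) (b : Subset n) l
                 → ((n ∸ ∣ b ∣) C l) * extCard U l ≤ linkCard U l (l + ∣ b ∣) b * (n C l)
ext-link-density {n} U b l
  rewrite sym (∣∁p∣≡n∸∣p∣ b) | extCard≡level U l | linkCard≡level U l b =
  link-density (above U) (above-upClosed U) b l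

-- Lemma 3.3.
lemma3p3 : (m l₀ : ℕ → ℕ) (U : (n : ℕ) → List (Subset n))
    → (∀ K → ∃ λ N → ∀ n → N ≤ n → K * (m n * m n) ≤ n)
    → ∃ λ N → ∀ n → N ≤ n
    → 1 ≤ m n → m n ≤ n
    → All (λ s → ∣ s ∣ ≡ m n) (U n)
    → 1 ≤ l₀ n → l₀ n ≤ n
    → m n * m n < l₀ n
    → (i : ℕ) → 1 ≤ i → (i + 1) * l₀ n ≤ n
    → (b : Subset n) → ∣ b ∣ ≡ i * l₀ n → ¬ InExt (U n) (i * l₀ n) b
    → ((n ∸ i * l₀ n) C l₀ n) * extCard (U n) (l₀ n)
    ≤ linkCard (U n) (l₀ n) ((i + 1) * l₀ n) b * (n C l₀ n)
lemma3p3 m l₀ U _ = 0 , λ n _ _ _ _ _ _ _ i _ _ b ∣b∣≡il₀ _ →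
  subst₂ (λ k l′ → ((n ∸ k) C l₀ n) * extCard (U n) (l₀ n) ≤ linkCard (U n) (l₀ n) l′ b * (n C l₀ n))
         ∣b∣≡il₀
         (trans (cong (l₀ n +_) ∣b∣≡il₀) (cong (_* l₀ n) (+-comm 1 i)))
         (ext-link-density (U n) b (l₀ n))
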